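{- Let $f(n)$ be the number of subsets $\{p_1<\cdots<p_k\}\subseteq\{1,\ldots,n\}$ (including the empty set) with $p_1+\cdots+p_j\le p_{j+1}$ for all $1\le j\le k-1$, let $b(n)$ be the number of non-squashing partitions of $n$ into distinct parts, and let $F(x)=\sum_{n\ge0}f(n)x^n$, $B(x)=\sum_{n\ge0}b(n)x^n$. Then $$F(x)=\frac{B(x)-x}{(1-x)^2},$$ and $$F(x)=\frac{(1+x)^2}{1-x}F(x^2)-\frac{x(1-2x^2)}{(1-x)^2(1-x^2)}.$$
   Context: A partition $n=p_1+p_2+\cdots+p_k$ with parts written in nondecreasing order $1\le p_1\le\cdots\le p_k$ is called non-squashing if $p_1+\cdots+p_j\le p_{j+1}$ for all $1\le j\le k-1$. The empty partition of $0$ is counted, so $b(0)=1$. Here $B(x)$ satisfies $B(x)=1+\frac{x}{1-x}+\sum_{i\ge1}\frac{x^{3\cdot2^{i-1}}}{\prod_{j=0}^{i}(1-x^{2^j})}$. -}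

module Defs where

open import Data.Nat as ℕ using (ℕ; zero; suc; _≤ᵇ_; _≡ᵇ_; _∸_)
open import Data.Integer as ℤ using (ℤ; +_; _+_; _*_; -_; _-_)
open import Data.List using (List; []; _∷_; _++_; map; filter; length; _∷ʳ_)
open import Data.Nat.ListAction using (sum)
open import Data.Bool using (Bool; true; false; _∧_; T)
open import Data.Bool.Properties using (T?)

-- All subsets of {1,…,n}, each represented as the list of its elements
-- in increasing order  p₁ < p₂ < ⋯ < p_k.
subsets : ℕ → List (List ℕ)
subsets zero    = [] ∷ []
subsets (suc n) = subsets n ++ map (λ s → s ∷ʳ suc n) (subsets n)

nonSquashingFrom : ℕ → List ℕ → Bool
nonSquashingFrom acc []       = true
nonSquashingFrom acc (p ∷ ps) = (acc ≤ᵇ p) ∧ nonSquashingFrom (acc ℕ.+ p) ps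

nonSquashing : List ℕ → Bool
nonSquashing = nonSquashingFrom 0

f : ℕ → ℕ
f n = length (filter (λ s → T? (nonSquashing s)) (subsets n))

-- A partition of n into distinct (positive) parts, written in increasing
-- order, is exactly a subset of {1,…,n} whose elements sum to n.
b : ℕ → ℕ
b n = length (filter (λ s → T? (nonSquashing s ∧ (sum s ≡ᵇ n))) (subsets n))

PS : Set
PS = ℕ → ℤ

sumTo : ℕ → (ℕ → ℤ) → ℤ
sumTo zero    g = g 0
sumTo (suc n) g = sumTo n g + g (suc n)

infixl 7 _⊗_
_⊗_ : PS → PS → PS
(a ⊗ c) n = sumTo n (λ k → a k * c (n ∸ k))

infixl 6 _⊕_ _⊖_
_⊕_ : PS → PS → PS
(a ⊕ c) n = a n + c n

_⊖_ : PS → PS → PS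
(a ⊖ c) n = a n - c n

poly : List ℤ → PS
poly []       n       = + 0
poly (c ∷ cs) zero    = c
poly (c ∷ cs) (suc n) = poly cs n

-- 1 / (1 - x^(k+1)) = Σ_m x^((k+1) m)
geomInv : ℕ → PS
geomInv k n = if-div (n ℕ.% suc k)
  where
  if-div : ℕ → ℤ
  if-div zero    = + 1
  if-div (suc _) = + 0

-- Substitution x ↦ x² : A(x) ↦ A(x²)
sq : PS → PS
sq a zero          = a 0
sq a (suc zero)    = + 0
sq a (suc (suc n)) = sq (λ m → a (suc m)) n

F : PS
F n = + f n

B : PS
B n = + b n

X : PS
X = poly (+ 0 ∷ + 1 ∷ [])

{-# OPTIONS --safe #-}

-- Adding n+1 to a non-squashing subset s of {1,…,n} keeps it non-squashing
-- exactly when sum s ≤ n+1.  So the sums of the non-squashing subsets of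
-- {1,…,n} obey a simple recursion in n, and counting them gives
-- f(n+1) − f(n) = b(0) + ⋯ + b(n+1) − 1, which is the first identity.
-- Counting instead those with a given sum N, and noting that the largest
-- part p of a non-squashing partition of N satisfies p ≥ N − p, gives
-- b(2m+1) = b(0) + ⋯ + b(m) and b(2m+2) = b(0) + ⋯ + b(m+1) − 1 (when
-- p = N − p the rest cannot be {p} itself).  These fix f(n+2) − f(n)
-- according to the parity of n; the right-hand side of the second identity
-- has the same second differences and the same first two coefficients.

module Submission where

open import Defs
open import Data.Nat as ℕ using (ℕ; zero; suc; _∸_; _≤_; z≤n)
import Data.Nat.Properties as ℕ

module NonSquashingSums where

  open import Data.Nat using (_+_; _*_; _<_; _≤ᵇ_; _≡ᵇ_; s≤s; _≟_; _≤?_)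
  open import Data.Nat.Properties
  open import Data.Nat.ListAction using (sum)
  open import Data.Nat.ListAction.Properties using (sum-++)
  open import Data.Nat.Tactic.RingSolver using (solve-∀)
  open import Data.Bool using (Bool; true; false; _∧_)
  open import Data.Bool.Properties using (∧-assoc; ∧-identityʳ; ∧-zeroʳ)
  open import Data.List using (List; []; _∷_; _++_; map; filterᵇ; length; _∷ʳ_)
  open import Data.List.Properties using (length-++; length-map)
  open import Function using (_∘_)
  open import Relation.Binary.PropositionalEquality
  open import Relation.Nullary.Decidable using (yes; no; dec-true; dec-false)

  indicator : Bool → ℕ
  indicator true  = 1
  indicator false = 0

  count : {A : Set} → (A → Bool) → List A → ℕ
  count p []       = 0
  count p (x ∷ xs) = indicator (p x) + count p xs

  module _ {A : Set} where

    length-filterᵇ : ∀ (p : A → Bool) xs → length (filterᵇ p xs) ≡ count p xs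
    length-filterᵇ p []       = refl
    length-filterᵇ p (x ∷ xs) with p x
    ... | true  = cong suc (length-filterᵇ p xs)
    ... | false = length-filterᵇ p xs

    count-true : ∀ (xs : List A) → count (λ _ → true) xs ≡ length xs
    count-true []       = refl
    count-true (x ∷ xs) = cong suc (count-true xs)

    count-++ : ∀ (p : A → Bool) xs ys → count p (xs ++ ys) ≡ count p xs + count p ys
    count-++ p []       ys = refl
    count-++ p (x ∷ xs) ys = trans (cong (indicator (p x) +_) (count-++ p xs ys))
                                   (sym (+-assoc (indicator (p x)) _ _))

    count-map : ∀ {B : Set} (p : B → Bool) (g : A → B) xs →
                count p (map g xs) ≡ count (p ∘ g) xs
    count-map p g []       = refl
    count-map p g (x ∷ xs) = cong (indicator (p (g x)) +_) (count-map p g xs)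

    count-filterᵇ : ∀ (p q : A → Bool) xs →
                    count q (filterᵇ p xs) ≡ count (λ x → p x ∧ q x) xs
    count-filterᵇ p q []       = refl
    count-filterᵇ p q (x ∷ xs) with p x
    ... | true  = cong (indicator (q x) +_) (count-filterᵇ p q xs)
    ... | false = count-filterᵇ p q xs

    count-cong : ∀ {p q : A → Bool} → (∀ x → p x ≡ q x) →
                 ∀ xs → count p xs ≡ count q xs
    count-cong p≗q []       = refl
    count-cong p≗q (x ∷ xs) = cong₂ _+_ (cong indicator (p≗q x)) (count-cong p≗q xs)

    count-none : ∀ {p : A → Bool} → (∀ x → p x ≡ false) → ∀ xs → count p xs ≡ 0
    count-none p≗false []       = refl
    count-none p≗false (x ∷ xs) rewrite p≗false x = count-none p≗false xs

    count-split : ∀ {p q r : A → Bool} →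
                  (∀ x → indicator (r x) ≡ indicator (p x) + indicator (q x)) →
                  ∀ xs → count r xs ≡ count p xs + count q xs
    count-split split []       = refl
    count-split {p} {q} split (x ∷ xs) =
      trans (cong₂ _+_ (split x) (count-split split xs))
            (+-exchange (indicator (p x)) (indicator (q x)) _ _)
      where
      +-exchange : ∀ a b c d → (a + b) + (c + d) ≡ (a + c) + (b + d)
      +-exchange = solve-∀

  nonSquashingFrom-∷ʳ : ∀ acc s m →
    nonSquashingFrom acc (s ∷ʳ m) ≡ nonSquashingFrom acc s ∧ (acc + sum s ≤ᵇ m)
  nonSquashingFrom-∷ʳ acc []      m rewrite +-identityʳ acc = ∧-identityʳ _
  nonSquashingFrom-∷ʳ acc (p ∷ s) m
    rewrite nonSquashingFrom-∷ʳ (acc + p) s m | +-assoc acc p (sum s) =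
    sym (∧-assoc (acc ≤ᵇ p) _ _)

  sum-∷ʳ : ∀ s m → sum (s ∷ʳ m) ≡ sum s + m
  sum-∷ʳ s m = trans (sum-++ s (m ∷ [])) (cong (sum s +_) (+-identityʳ m))

  -- The sums of the non-squashing subsets of {1,…,n}, with multiplicity.
  nonSquashingSums : ℕ → List ℕ
  nonSquashingSums zero    = 0 ∷ []
  nonSquashingSums (suc n) =
    nonSquashingSums n ++ map (_+ suc n) (filterᵇ (_≤ᵇ suc n) (nonSquashingSums n))

  count-nonSquashingSums-suc : ∀ n (q : ℕ → Bool) →
    count q (nonSquashingSums (suc n))
      ≡ count q (nonSquashingSums n)
        + count (λ y → (y ≤ᵇ suc n) ∧ q (y + suc n)) (nonSquashingSums n)
  count-nonSquashingSums-suc n q =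
    trans (count-++ q (nonSquashingSums n) _)
          (cong (count q (nonSquashingSums n) +_)
                (trans (count-map q (_+ suc n) (filterᵇ (_≤ᵇ suc n) (nonSquashingSums n)))
                       (count-filterᵇ (_≤ᵇ suc n) (q ∘ (_+ suc n)) (nonSquashingSums n))))

  count-subsets-bySum : ∀ n (q : ℕ → Bool) →
    count (λ s → nonSquashing s ∧ q (sum s)) (subsets n) ≡ count q (nonSquashingSums n)
  count-subsets-bySum zero    q = refl
  count-subsets-bySum (suc n) q = begin
      count P (subsets n ++ map (_∷ʳ suc n) (subsets n))
    ≡⟨ count-++ P (subsets n) _ ⟩
      count P (subsets n) + count P (map (_∷ʳ suc n) (subsets n))
    ≡⟨ cong (count P (subsets n) +_) (count-map P (_∷ʳ suc n) (subsets n)) ⟩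
      count P (subsets n) + count (P ∘ (_∷ʳ suc n)) (subsets n)
    ≡⟨ cong (count P (subsets n) +_) (count-cong P-∷ʳ (subsets n)) ⟩
      count P (subsets n) + count (λ s → nonSquashing s ∧ q′ (sum s)) (subsets n)
    ≡⟨ cong₂ _+_ (count-subsets-bySum n q) (count-subsets-bySum n q′) ⟩
      count q (nonSquashingSums n) + count q′ (nonSquashingSums n)
    ≡⟨ count-nonSquashingSums-suc n q ⟨
      count q (nonSquashingSums (suc n)) ∎
    where
    open ≡-Reasoning
    P : List ℕ → Bool
    P s = nonSquashing s ∧ q (sum s)
    q′ : ℕ → Bool
    q′ y = (y ≤ᵇ suc n) ∧ q (y + suc n)
    P-∷ʳ : ∀ s → P (s ∷ʳ suc n) ≡ nonSquashing s ∧ q′ (sum s)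
    P-∷ʳ s rewrite nonSquashingFrom-∷ʳ 0 s (suc n) | sum-∷ʳ s (suc n) =
      ∧-assoc (nonSquashing s) _ _

  ways ways≤ : ℕ → ℕ → ℕ
  ways  n k = count (_≡ᵇ k) (nonSquashingSums n)
  ways≤ n t = count (_≤ᵇ t) (nonSquashingSums n)

  f≡length : ∀ n → f n ≡ length (nonSquashingSums n)
  f≡length n = begin
      length (filterᵇ nonSquashing (subsets n))
    ≡⟨ length-filterᵇ nonSquashing (subsets n) ⟩
      count nonSquashing (subsets n)
    ≡⟨ count-cong (λ s → sym (∧-identityʳ (nonSquashing s))) (subsets n) ⟩
      count (λ s → nonSquashing s ∧ true) (subsets n)
    ≡⟨ count-subsets-bySum n (λ _ → true) ⟩
      count (λ _ → true) (nonSquashingSums n)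
    ≡⟨ count-true (nonSquashingSums n) ⟩
      length (nonSquashingSums n) ∎
    where open ≡-Reasoning

  b≡ways : ∀ n → b n ≡ ways n n
  b≡ways n = trans (length-filterᵇ (λ s → nonSquashing s ∧ (sum s ≡ᵇ n)) (subsets n))
                   (count-subsets-bySum n (_≡ᵇ n))

  length-nonSquashingSums-suc : ∀ n →
    length (nonSquashingSums (suc n)) ≡ length (nonSquashingSums n) + ways≤ n (suc n)
  length-nonSquashingSums-suc n = begin
      length (nonSquashingSums n ++ map (_+ suc n) small)
    ≡⟨ length-++ (nonSquashingSums n) ⟩
      length (nonSquashingSums n) + length (map (_+ suc n) small)
    ≡⟨ cong (length (nonSquashingSums n) +_) (length-map (_+ suc n) small) ⟩
      length (nonSquashingSums n) + length small
    ≡⟨ cong (length (nonSquashingSums n) +_) (length-filterᵇ (_≤ᵇ suc n) (nonSquashingSums n)) ⟩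
      length (nonSquashingSums n) + ways≤ n (suc n) ∎
    where
    open ≡-Reasoning
    small : List ℕ
    small = filterᵇ (_≤ᵇ suc n) (nonSquashingSums n)

  ways-suc-unchanged : ∀ n k → (∀ y → y ≤ suc n → y + suc n ≢ k) →
                       ways (suc n) k ≡ ways n k
  ways-suc-unchanged n k missed = begin
      ways (suc n) k
    ≡⟨ count-nonSquashingSums-suc n (_≡ᵇ k) ⟩
      ways n k + count (λ y → (y ≤ᵇ suc n) ∧ (y + suc n ≡ᵇ k)) (nonSquashingSums n)
    ≡⟨ cong (ways n k +_) (count-none no-new (nonSquashingSums n)) ⟩
      ways n k + 0
    ≡⟨ +-identityʳ (ways n k) ⟩
      ways n k ∎
    where
    open ≡-Reasoning
    no-new : ∀ y → (y ≤ᵇ suc n) ∧ (y + suc n ≡ᵇ k) ≡ false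
    no-new y with y ≤? suc n
    ... | yes y≤n+1 rewrite dec-false (y + suc n ≟ k) (missed y y≤n+1) = ∧-zeroʳ _
    ... | no  y≰n+1 rewrite dec-false (y ≤? suc n) y≰n+1             = refl

  ways-suc-small : ∀ n k → k ≤ n → ways (suc n) k ≡ ways n k
  ways-suc-small n k k≤n = ways-suc-unchanged n k λ y _ y+n+1≡k →
    <⇒≢ (≤-trans (s≤s k≤n) (m≤n+m (suc n) y)) (sym y+n+1≡k)

  ways-suc-large : ∀ n k → suc n + suc n < k → ways (suc n) k ≡ ways n k
  ways-suc-large n k 2n+2<k = ways-suc-unchanged n k λ y y≤n+1 →
    <⇒≢ (≤-<-trans (+-monoˡ-≤ (suc n) y≤n+1) 2n+2<k)

  ways-suc-shift : ∀ n x → x ≤ suc n →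
                   ways (suc n) (x + suc n) ≡ ways n (x + suc n) + ways n x
  ways-suc-shift n x x≤n+1 =
    trans (count-nonSquashingSums-suc n (_≡ᵇ x + suc n))
          (cong (ways n (x + suc n) +_) (count-cong new≡x (nonSquashingSums n)))
    where
    new≡x : ∀ y → (y ≤ᵇ suc n) ∧ (y + suc n ≡ᵇ x + suc n) ≡ (y ≡ᵇ x)
    new≡x y with y ≟ x
    ... | yes refl
      rewrite dec-true (y ≤? suc n) x≤n+1
            | dec-true (y + suc n ≟ y + suc n) refl
            | dec-true (y ≟ y) refl
      = refl
    ... | no y≢x
      rewrite dec-false (y + suc n ≟ x + suc n) (y≢x ∘ +-cancelʳ-≡ (suc n) y x)
            | dec-false (y ≟ x) y≢x
      = ∧-zeroʳ _

  Σb< : ℕ → ℕ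
  Σb< zero    = 0
  Σb< (suc x) = Σb< x + b x

  ways-large : ∀ n k → n + n < k → ways n k ≡ 0
  ways-large zero    (suc k) _      = refl
  ways-large (suc n) k       2n+2<k =
    trans (ways-suc-large n k 2n+2<k)
          (ways-large n k (≤-<-trans (+-mono-≤ (n≤1+n n) (n≤1+n n)) 2n+2<k))

  ways-zero : ∀ n → ways n 0 ≡ 1
  ways-zero zero    = refl
  ways-zero (suc n) = trans (ways-suc-small n 0 z≤n) (ways-zero n)

  ways≡b : ∀ {n k} → k ≤ n → ways n k ≡ b k
  ways≡b {n} {k} k≤n = subst (λ m → ways m k ≡ b k) (m∸n+n≡m k≤n) (stable (n ∸ k))
    where
    stable : ∀ d → ways (d + k) k ≡ b k
    stable zero    = sym (b≡ways k)
    stable (suc d) = trans (ways-suc-small (d + k) k (m≤n+m k d)) (stable d)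

  b-suc : ∀ n → b (suc n) ≡ ways n (suc n) + 1
  b-suc n = begin
      b (suc n)
    ≡⟨ b≡ways (suc n) ⟩
      ways (suc n) (suc n)
    ≡⟨ ways-suc-shift n 0 z≤n ⟩
      ways n (suc n) + ways n 0
    ≡⟨ cong (ways n (suc n) +_) (ways-zero n) ⟩
      ways n (suc n) + 1 ∎
    where open ≡-Reasoning

  indicator-≤ᵇ-suc : ∀ y t →
    indicator (y ≤ᵇ suc t) ≡ indicator (y ≤ᵇ t) + indicator (y ≡ᵇ suc t)
  indicator-≤ᵇ-suc zero          t       = refl
  indicator-≤ᵇ-suc (suc zero)    zero    = refl
  indicator-≤ᵇ-suc (suc (suc y)) zero    = refl
  indicator-≤ᵇ-suc (suc zero)    (suc t) = refl
  indicator-≤ᵇ-suc (suc (suc y)) (suc t) = indicator-≤ᵇ-suc (suc y) t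

  ways≤-suc : ∀ n t → ways≤ n (suc t) ≡ ways≤ n t + ways n (suc t)
  ways≤-suc n t = count-split (λ y → indicator-≤ᵇ-suc y t) (nonSquashingSums n)

  ways≤-zero : ∀ n → ways≤ n 0 ≡ 1
  ways≤-zero n = trans (count-cong ≤ᵇ0 (nonSquashingSums n)) (ways-zero n)
    where
    ≤ᵇ0 : ∀ y → (y ≤ᵇ 0) ≡ (y ≡ᵇ 0)
    ≤ᵇ0 zero    = refl
    ≤ᵇ0 (suc y) = refl

  ways≤≡Σb< : ∀ {n t} → t ≤ n → ways≤ n t ≡ Σb< (suc t)
  ways≤≡Σb< {n} {zero}  _   = ways≤-zero n
  ways≤≡Σb< {n} {suc t} t<n =
    trans (ways≤-suc n t) (cong₂ _+_ (ways≤≡Σb< (<⇒≤ t<n)) (ways≡b t<n))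

  f-suc : ∀ n → f (suc n) + 1 ≡ f n + Σb< (2 + n)
  f-suc n = begin
      f (suc n) + 1
    ≡⟨ cong (_+ 1) (trans (f≡length (suc n)) (length-nonSquashingSums-suc n)) ⟩
      length (nonSquashingSums n) + ways≤ n (suc n) + 1
    ≡⟨ cong (λ w → length (nonSquashingSums n) + w + 1) (ways≤-suc n n) ⟩
      length (nonSquashingSums n) + (ways≤ n n + ways n (suc n)) + 1
    ≡⟨ reassoc (length (nonSquashingSums n)) (ways≤ n n) (ways n (suc n)) ⟩
      length (nonSquashingSums n) + (ways≤ n n + (ways n (suc n) + 1))
    ≡⟨ cong₂ (λ l w → l + (w + (ways n (suc n) + 1)))
             (sym (f≡length n)) (ways≤≡Σb< {n} ≤-refl) ⟩
      f n + (Σb< (suc n) + (ways n (suc n) + 1))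
    ≡⟨ cong (λ c → f n + (Σb< (suc n) + c)) (sym (b-suc n)) ⟩
      f n + Σb< (2 + n) ∎
    where
    open ≡-Reasoning
    reassoc : ∀ l s w → l + (s + w) + 1 ≡ l + (s + (w + 1))
    reassoc = solve-∀

  -- With N = x + (r + j), each new largest element i ∈ {j+1,…,r+j} adds the
  -- b (N − i) subsets whose other parts sum to N − i, which is ≤ i − 1.
  ways-descend : ∀ r j x → x + r ≤ suc j →
    ways (r + j) (x + (r + j)) + Σb< x ≡ ways j (x + (r + j)) + Σb< (x + r)
  ways-descend zero    j x _ rewrite +-identityʳ x = refl
  ways-descend (suc r) j x x+r+1≤j+1 = begin
      ways (suc n) (x + suc n) + Σb< x
    ≡⟨ cong (_+ Σb< x) (ways-suc-shift n x (≤-trans x≤n (n≤1+n n))) ⟩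
      ways n (x + suc n) + ways n x + Σb< x
    ≡⟨ cong (λ w → ways n (x + suc n) + w + Σb< x) (ways≡b x≤n) ⟩
      ways n (x + suc n) + b x + Σb< x
    ≡⟨ +-assoc (ways n (x + suc n)) (b x) (Σb< x) ⟩
      ways n (x + suc n) + (b x + Σb< x)
    ≡⟨ cong₂ (λ N s → ways n N + s) (+-suc x n) (+-comm (b x) (Σb< x)) ⟩
      ways n (suc x + n) + Σb< (suc x)
    ≡⟨ ways-descend r j (suc x) x+1+r≤j+1 ⟩
      ways j (suc x + n) + Σb< (suc x + r)
    ≡⟨ cong₂ (λ N y → ways j N + Σb< y) (+-suc x n) (+-suc x r) ⟨
      ways j (x + suc n) + Σb< (x + suc r) ∎
    where
    open ≡-Reasoning
    n : ℕ
    n = r + j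
    x+1+r≤j+1 : suc x + r ≤ suc j
    x+1+r≤j+1 = subst (_≤ suc j) (+-suc x r) x+r+1≤j+1
    x≤n : x ≤ n
    x≤n = ≤-trans (m≤m+n x r) (≤-trans (≤-pred x+1+r≤j+1) (m≤n+m j r))

  b-odd : ∀ m → b (suc (m + m)) ≡ Σb< (suc m)
  b-odd m = begin
      b (suc (m + m))
    ≡⟨ b-suc (m + m) ⟩
      ways (m + m) (suc (m + m)) + 1
    ≡⟨ ways-descend m m 1 ≤-refl ⟩
      ways m (suc (m + m)) + Σb< (suc m)
    ≡⟨ cong (_+ Σb< (suc m)) (ways-large m (suc (m + m)) ≤-refl) ⟩
      Σb< (suc m) ∎
    where open ≡-Reasoning

  b-even : ∀ m → b (suc (suc (m + m))) + 1 ≡ Σb< (suc (suc m))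
  b-even m = begin
      b (suc (suc (m + m))) + 1
    ≡⟨ cong (_+ 1) (b-suc (suc (m + m))) ⟩
      ways (suc (m + m)) (suc (suc (m + m))) + 1 + 1
    ≡⟨ cong (λ n → ways n (suc n) + 1 + 1) (+-suc m m) ⟨
      ways (m + suc m) (1 + (m + suc m)) + 1 + 1
    ≡⟨ cong (_+ 1) (ways-descend m (suc m) 1 (n≤1+n (suc m))) ⟩
      ways (suc m) (suc m + suc m) + Σb< (suc m) + 1
    ≡⟨ cong (λ w → w + Σb< (suc m) + 1) top ⟩
      ways m (suc m) + Σb< (suc m) + 1
    ≡⟨ reassoc (ways m (suc m)) (Σb< (suc m)) ⟩
      Σb< (suc m) + (ways m (suc m) + 1)
    ≡⟨ cong (Σb< (suc m) +_) (b-suc m) ⟨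
      Σb< (suc (suc m)) ∎
    where
    open ≡-Reasoning
    reassoc : ∀ w s → w + s + 1 ≡ s + (w + 1)
    reassoc = solve-∀
    m+m<2+m+m : m + m < suc m + suc m
    m+m<2+m+m = s≤s (+-monoʳ-≤ m (n≤1+n m))
    top : ways (suc m) (suc m + suc m) ≡ ways m (suc m)
    top = trans (ways-suc-shift m (suc m) ≤-refl)
                (cong (_+ ways m (suc m)) (ways-large m (suc m + suc m) m+m<2+m+m))

  b-odd-suc : ∀ m → b (3 + (m + m)) ≡ Σb< (2 + m)
  b-odd-suc m =
    subst (λ k → b (suc k) ≡ Σb< (2 + m)) (cong suc (+-suc m m)) (b-odd (suc m))

  b-even-suc : ∀ m → b (4 + (m + m)) + 1 ≡ Σb< (3 + m)
  b-even-suc m =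
    subst (λ k → b (suc (suc k)) + 1 ≡ Σb< (3 + m)) (cong suc (+-suc m m)) (b-even (suc m))

  Σb<-pair-even : ∀ m →
    Σb< (2 + (m + m)) + Σb< (3 + (m + m)) ≡ f (suc m) + 3 * f m + (m + m)
  Σb<-pair-even zero    = refl
  Σb<-pair-even (suc m) rewrite +-suc m m = +-cancelʳ-≡ 4 _ _ (begin
      Σb< (4 + M) + Σb< (5 + M) + 4
    ≡⟨ expand (Σb< (2 + M)) (b (2 + M)) (b (3 + M)) (b (4 + M)) ⟩
      (Σb< (2 + M) + Σb< (3 + M)) + (b (2 + M) + 1) + 2 * b (3 + M) + (b (4 + M) + 1) + 2
    ≡⟨ cong₂ (λ p q → p + q + 2 * b (3 + M) + (b (4 + M) + 1) + 2)
             (Σb<-pair-even m) (b-even m) ⟩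
      (f (1 + m) + 3 * f m + M) + Σb< (2 + m) + 2 * b (3 + M) + (b (4 + M) + 1) + 2
    ≡⟨ cong₂ (λ p q → (f (1 + m) + 3 * f m + M) + Σb< (2 + m) + 2 * p + q + 2)
             (b-odd-suc m) (b-even-suc m) ⟩
      (f (1 + m) + 3 * f m + M) + Σb< (2 + m) + 2 * Σb< (2 + m) + Σb< (3 + m) + 2
    ≡⟨ regroup (f (1 + m)) (f m) M (Σb< (2 + m)) (Σb< (3 + m)) ⟩
      (f (1 + m) + Σb< (3 + m)) + 3 * (f m + Σb< (2 + m)) + M + 2
    ≡⟨ cong₂ (λ p q → p + 3 * q + M + 2) (f-suc (suc m)) (f-suc m) ⟨
      (f (2 + m) + 1) + 3 * (f (1 + m) + 1) + M + 2
    ≡⟨ collect (f (2 + m)) (f (1 + m)) M ⟩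
      f (2 + m) + 3 * f (1 + m) + (2 + M) + 4 ∎)
    where
    open ≡-Reasoning
    M : ℕ
    M = m + m
    expand : ∀ s b₂ b₃ b₄ → ((s + b₂) + b₃) + (((s + b₂) + b₃) + b₄) + 4
                            ≡ (s + (s + b₂)) + (b₂ + 1) + 2 * b₃ + (b₄ + 1) + 2
    expand = solve-∀
    regroup : ∀ f₁ f₀ M s₂ s₃ → (f₁ + 3 * f₀ + M) + s₂ + 2 * s₂ + s₃ + 2
                                ≡ (f₁ + s₃) + 3 * (f₀ + s₂) + M + 2
    regroup = solve-∀
    collect : ∀ f₂ f₁ M → (f₂ + 1) + 3 * (f₁ + 1) + M + 2 ≡ f₂ + 3 * f₁ + (2 + M) + 4
    collect = solve-∀

  Σb<-pair-odd : ∀ m →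
    Σb< (3 + (m + m)) + Σb< (4 + (m + m)) ≡ 3 * f (suc m) + f m + suc (m + m)
  Σb<-pair-odd m = +-cancelʳ-≡ 1 _ _ (begin
      Σb< (3 + M) + Σb< (4 + M) + 1
    ≡⟨ expand (Σb< (2 + M)) (b (2 + M)) (b (3 + M)) ⟩
      (Σb< (2 + M) + Σb< (3 + M)) + (b (2 + M) + 1) + b (3 + M)
    ≡⟨ cong₂ _+_ (cong₂ _+_ (Σb<-pair-even m) (b-even m)) (b-odd-suc m) ⟩
      (f (1 + m) + 3 * f m + M) + Σb< (2 + m) + Σb< (2 + m)
    ≡⟨ regroup (f (1 + m)) (f m) M (Σb< (2 + m)) ⟩
      f (1 + m) + 2 * (f m + Σb< (2 + m)) + f m + M
    ≡⟨ cong (λ p → f (1 + m) + 2 * p + f m + M) (f-suc m) ⟨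
      f (1 + m) + 2 * (f (1 + m) + 1) + f m + M
    ≡⟨ collect (f (1 + m)) (f m) M ⟩
      3 * f (1 + m) + f m + suc M + 1 ∎)
    where
    open ≡-Reasoning
    M : ℕ
    M = m + m
    expand : ∀ s b₂ b₃ →
             (s + b₂) + ((s + b₂) + b₃) + 1 ≡ (s + (s + b₂)) + (b₂ + 1) + b₃
    expand = solve-∀
    regroup : ∀ f₁ f₀ M s₂ →
              (f₁ + 3 * f₀ + M) + s₂ + s₂ ≡ f₁ + 2 * (f₀ + s₂) + f₀ + M
    regroup = solve-∀
    collect : ∀ f₁ f₀ M → f₁ + 2 * (f₁ + 1) + f₀ + M ≡ 3 * f₁ + f₀ + suc M + 1
    collect = solve-∀

open NonSquashingSums using (Σb<; f-suc; Σb<-pair-even; Σb<-pair-odd)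
open import Data.Nat.DivMod using (n%1≡0)
open import Data.Integer using (ℤ; +_; -[1+_]; _+_; _*_; _-_; -_)
open import Data.Integer.Properties
open import Data.Integer.Tactic.RingSolver using (solve-∀)
open import Data.List using ([]; _∷_)
open import Data.Product using (_×_; _,_)
open import Function using (_∘_)
open import Relation.Binary.PropositionalEquality
  using (_≡_; refl; sym; trans; cong; cong₂; subst; module ≡-Reasoning)

sumTo-cong : ∀ n {g h : ℕ → ℤ} → (∀ k → k ≤ n → g k ≡ h k) → sumTo n g ≡ sumTo n h
sumTo-cong zero    g≗h = g≗h 0 z≤n
sumTo-cong (suc n) g≗h =
  cong₂ _+_ (sumTo-cong n (λ k k≤n → g≗h k (ℕ.m≤n⇒m≤1+n k≤n))) (g≗h (suc n) ℕ.≤-refl)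

sumTo-suc : ∀ n (g : ℕ → ℤ) → sumTo (suc n) g ≡ g 0 + sumTo n (g ∘ suc)
sumTo-suc zero    g = refl
sumTo-suc (suc n) g = trans (cong (_+ g (2 ℕ.+ n)) (sumTo-suc n g)) (+-assoc (g 0) _ _)

sumTo-+ : ∀ n (g h : ℕ → ℤ) → sumTo n (λ k → g k + h k) ≡ sumTo n g + sumTo n h
sumTo-+ zero    g h = refl
sumTo-+ (suc n) g h =
  trans (cong (_+ (g (suc n) + h (suc n))) (sumTo-+ n g h)) (exchange (sumTo n g) (sumTo n h) _ _)
  where
  exchange : ∀ a b c d → (a + b) + (c + d) ≡ (a + c) + (b + d)
  exchange = solve-∀

sumTo-unique : ∀ {a d : ℕ → ℤ} → a 0 ≡ d 0 → (∀ n → a (suc n) ≡ a n + d (suc n)) →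
               ∀ n → a n ≡ sumTo n d
sumTo-unique a₀ step zero    = a₀
sumTo-unique {a} {d} a₀ step (suc n) =
  trans (step n) (cong (_+ d (suc n)) (sumTo-unique {a} a₀ step n))

agree-by-step2 : ∀ {a c : ℕ → ℤ} (d : ℕ → ℤ) → a 0 ≡ c 0 → a 1 ≡ c 1 →
                 (∀ n → a (2 ℕ.+ n) ≡ a n + d n) → (∀ n → c (2 ℕ.+ n) ≡ c n + d n) →
                 ∀ n → a n ≡ c n
agree-by-step2 d a₀ a₁ stepᵃ stepᶜ zero          = a₀
agree-by-step2 d a₀ a₁ stepᵃ stepᶜ (suc zero)    = a₁
agree-by-step2 {a} {c} d a₀ a₁ stepᵃ stepᶜ (suc (suc n)) =
  trans (stepᵃ n)
        (trans (cong (_+ d n) (agree-by-step2 {a} {c} d a₀ a₁ stepᵃ stepᶜ n)) (sym (stepᶜ n)))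

geomInv-0 : ∀ n → geomInv 0 n ≡ + 1
geomInv-0 n rewrite n%1≡0 n = refl

⊗-geomInv-0 : ∀ a n → (a ⊗ geomInv 0) n ≡ sumTo n a
⊗-geomInv-0 a n =
  sumTo-cong n (λ k _ → trans (cong (a k *_) (geomInv-0 (n ∸ k))) (*-identityʳ (a k)))

⊗-geomInv-0-suc : ∀ a n → (a ⊗ geomInv 0) (suc n) ≡ (a ⊗ geomInv 0) n + a (suc n)
⊗-geomInv-0-suc a n =
  trans (⊗-geomInv-0 a (suc n)) (cong (_+ a (suc n)) (sym (⊗-geomInv-0 a n)))

⊗-geomInv-1-suc-suc : ∀ a n → (a ⊗ geomInv 1) (2 ℕ.+ n) ≡ (a ⊗ geomInv 1) n + a (2 ℕ.+ n)
⊗-geomInv-1-suc-suc a n = begin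
    sumTo n g + g (1 ℕ.+ n) + g (2 ℕ.+ n)
  ≡⟨ cong₂ (λ s i → s + a (1 ℕ.+ n) * geomInv 1 i + g (2 ℕ.+ n))
           (sumTo-cong n earlier) (ℕ.m+n∸n≡m 1 n) ⟩
    (a ⊗ geomInv 1) n + a (1 ℕ.+ n) * + 0 + g (2 ℕ.+ n)
  ≡⟨ cong₂ (λ s i → (a ⊗ geomInv 1) n + s + a (2 ℕ.+ n) * geomInv 1 i)
           (*-zeroʳ (a (1 ℕ.+ n))) (ℕ.n∸n≡0 n) ⟩
    (a ⊗ geomInv 1) n + + 0 + a (2 ℕ.+ n) * + 1
  ≡⟨ cong₂ _+_ (+-identityʳ ((a ⊗ geomInv 1) n)) (*-identityʳ (a (2 ℕ.+ n))) ⟩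
    (a ⊗ geomInv 1) n + a (2 ℕ.+ n) ∎
  where
  open ≡-Reasoning
  g : ℕ → ℤ
  g k = a k * geomInv 1 (2 ℕ.+ n ∸ k)
  earlier : ∀ k → k ≤ n → g k ≡ a k * geomInv 1 (n ∸ k)
  earlier k k≤n = cong (λ i → a k * geomInv 1 i) (ℕ.+-∸-assoc 2 k≤n)

⊗-geomInv-0-⊗-suc : ∀ a c n →
  (a ⊗ geomInv 0 ⊗ c) (suc n) ≡ (a ⊗ geomInv 0 ⊗ c) n + (a ⊗ c) (suc n)
⊗-geomInv-0-⊗-suc a c n = begin
    (A ⊗ c) (suc n)
  ≡⟨ sumTo-suc n (λ k → A k * c (suc n ∸ k)) ⟩
    A 0 * c (suc n) + sumTo n (λ k → A (suc k) * c (n ∸ k))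
  ≡⟨ cong₂ _+_ (cong (_* c (suc n)) (*-identityʳ (a 0))) (sumTo-cong n (λ k _ → split k)) ⟩
    a 0 * c (suc n) + sumTo n (λ k → A k * c (n ∸ k) + a (suc k) * c (n ∸ k))
  ≡⟨ cong (_+_ (a 0 * c (suc n))) (sumTo-+ n (λ k → A k * c (n ∸ k)) (λ k → a (suc k) * c (n ∸ k))) ⟩
    a 0 * c (suc n) + ((A ⊗ c) n + sumTo n (λ k → a (suc k) * c (n ∸ k)))
  ≡⟨ swap (a 0 * c (suc n)) ((A ⊗ c) n) _ ⟩
    (A ⊗ c) n + (a 0 * c (suc n) + sumTo n (λ k → a (suc k) * c (n ∸ k)))
  ≡⟨ cong (_+_ ((A ⊗ c) n)) (sumTo-suc n (λ k → a k * c (suc n ∸ k))) ⟨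
    (A ⊗ c) n + (a ⊗ c) (suc n) ∎
  where
  open ≡-Reasoning
  A : PS
  A = a ⊗ geomInv 0
  split : ∀ k → A (suc k) * c (n ∸ k) ≡ A k * c (n ∸ k) + a (suc k) * c (n ∸ k)
  split k = trans (cong (_* c (n ∸ k)) (⊗-geomInv-0-suc a k))
                  (*-distribʳ-+ (c (n ∸ k)) (A k) (a (suc k)))
  swap : ∀ x y z → x + (y + z) ≡ y + (x + z)
  swap = solve-∀

poly-⊗-suc : ∀ p ps c n → (poly (p ∷ ps) ⊗ c) (suc n) ≡ p * c (suc n) + (poly ps ⊗ c) n
poly-⊗-suc p ps c n = sumTo-suc n (λ k → poly (p ∷ ps) k * c (suc n ∸ k))

poly-[]-⊗ : ∀ c n → (poly [] ⊗ c) n ≡ + 0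
poly-[]-⊗ c zero    = refl
poly-[]-⊗ c (suc n) = cong (_+ + 0) (poly-[]-⊗ c n)

poly-1-⊗ : ∀ c n → (poly (+ 1 ∷ []) ⊗ c) n ≡ c n
poly-1-⊗ c zero    = *-identityˡ (c 0)
poly-1-⊗ c (suc n) = begin
    (poly (+ 1 ∷ []) ⊗ c) (suc n)
  ≡⟨ poly-⊗-suc (+ 1) [] c n ⟩
    + 1 * c (suc n) + (poly [] ⊗ c) n
  ≡⟨ cong₂ _+_ (*-identityˡ (c (suc n))) (poly-[]-⊗ c n) ⟩
    c (suc n) + + 0
  ≡⟨ +-identityʳ (c (suc n)) ⟩
    c (suc n) ∎
  where open ≡-Reasoning

sq-even : ∀ a m → sq a (m ℕ.+ m) ≡ a m
sq-even a zero    = refl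
sq-even a (suc m) rewrite ℕ.+-suc m m = sq-even (a ∘ suc) m

sq-odd : ∀ a m → sq a (suc (m ℕ.+ m)) ≡ + 0
sq-odd a zero    = refl
sq-odd a (suc m) rewrite ℕ.+-suc m m = sq-odd (a ∘ suc) m

data EvenOrOdd : ℕ → Set where
  even : ∀ m → EvenOrOdd (m ℕ.+ m)
  odd  : ∀ m → EvenOrOdd (suc (m ℕ.+ m))

evenOrOdd : ∀ n → EvenOrOdd n
evenOrOdd zero    = even 0
evenOrOdd (suc n) with evenOrOdd n
... | even m = odd m
... | odd  m = subst EvenOrOdd (cong suc (ℕ.+-suc m m)) (even (suc m))

[1+x]² x[1-2x²] : PS
[1+x]²    = poly (+ 1 ∷ + 2 ∷ + 1 ∷ [])
x[1-2x²] = poly (+ 0 ∷ + 1 ∷ + 0 ∷ -[1+ 1 ] ∷ [])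

[1+x]²/[1-x]·sq : PS → PS
[1+x]²/[1-x]·sq a = [1+x]² ⊗ geomInv 0 ⊗ sq a

x[1-2x²]/[1-x]²[1-x²] : PS
x[1-2x²]/[1-x]²[1-x²] = x[1-2x²] ⊗ geomInv 0 ⊗ geomInv 0 ⊗ geomInv 1

[1+x]²-⊗-suc-suc : ∀ c k → ([1+x]² ⊗ c) (2 ℕ.+ k) ≡ c (2 ℕ.+ k) + + 2 * c (suc k) + c k
[1+x]²-⊗-suc-suc c k = begin
    ([1+x]² ⊗ c) (2 ℕ.+ k)
  ≡⟨ poly-⊗-suc (+ 1) _ c (suc k) ⟩
    + 1 * c (2 ℕ.+ k) + (poly (+ 2 ∷ + 1 ∷ []) ⊗ c) (suc k)
  ≡⟨ cong₂ _+_ (*-identityˡ (c (2 ℕ.+ k))) (poly-⊗-suc (+ 2) _ c k) ⟩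
    c (2 ℕ.+ k) + (+ 2 * c (suc k) + (poly (+ 1 ∷ []) ⊗ c) k)
  ≡⟨ cong (λ t → c (2 ℕ.+ k) + (+ 2 * c (suc k) + t)) (poly-1-⊗ c k) ⟩
    c (2 ℕ.+ k) + (+ 2 * c (suc k) + c k)
  ≡⟨ +-assoc (c (2 ℕ.+ k)) _ _ ⟨
    c (2 ℕ.+ k) + + 2 * c (suc k) + c k ∎
  where open ≡-Reasoning

[1+x]²-⊗-sq-even : ∀ a m → ([1+x]² ⊗ sq a) (2 ℕ.+ (m ℕ.+ m)) ≡ a (suc m) + a m
[1+x]²-⊗-sq-even a m = begin
    ([1+x]² ⊗ sq a) (2 ℕ.+ M)
  ≡⟨ [1+x]²-⊗-suc-suc (sq a) M ⟩
    sq (a ∘ suc) M + + 2 * sq a (suc M) + sq a M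
  ≡⟨ cong₂ (λ s t → s + + 2 * t + sq a M) (sq-even (a ∘ suc) m) (sq-odd a m) ⟩
    a (suc m) + + 0 + sq a M
  ≡⟨ cong₂ _+_ (+-identityʳ (a (suc m))) (sq-even a m) ⟩
    a (suc m) + a m ∎
  where
  open ≡-Reasoning
  M : ℕ
  M = m ℕ.+ m

[1+x]²-⊗-sq-odd-suc : ∀ a m → ([1+x]² ⊗ sq a) (3 ℕ.+ (m ℕ.+ m)) ≡ + 2 * a (suc m)
[1+x]²-⊗-sq-odd-suc a m = begin
    ([1+x]² ⊗ sq a) (3 ℕ.+ M)
  ≡⟨ [1+x]²-⊗-suc-suc (sq a) (suc M) ⟩
    sq (a ∘ suc) (suc M) + + 2 * sq (a ∘ suc) M + sq a (suc M)
  ≡⟨ cong₂ (λ s t → s + + 2 * t + sq a (suc M)) (sq-odd (a ∘ suc) m) (sq-even (a ∘ suc) m) ⟩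
    + 0 + + 2 * a (suc m) + sq a (suc M)
  ≡⟨ cong₂ _+_ (+-identityˡ (+ 2 * a (suc m))) (sq-odd a m) ⟩
    + 2 * a (suc m) + + 0
  ≡⟨ +-identityʳ (+ 2 * a (suc m)) ⟩
    + 2 * a (suc m) ∎
  where
  open ≡-Reasoning
  M : ℕ
  M = m ℕ.+ m

[1+x]²-⊗-sq-odd : ∀ a m → ([1+x]² ⊗ sq a) (suc (m ℕ.+ m)) ≡ + 2 * a m
[1+x]²-⊗-sq-odd a zero    = +-identityˡ (+ 2 * a 0)
[1+x]²-⊗-sq-odd a (suc m) rewrite ℕ.+-suc m m = [1+x]²-⊗-sq-odd-suc a m

[1+x]²/[1-x]·sq-suc-suc : ∀ a n →
  [1+x]²/[1-x]·sq a (2 ℕ.+ n)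
    ≡ [1+x]²/[1-x]·sq a n + (([1+x]² ⊗ sq a) (suc n) + ([1+x]² ⊗ sq a) (2 ℕ.+ n))
[1+x]²/[1-x]·sq-suc-suc a n = begin
    [1+x]²/[1-x]·sq a (2 ℕ.+ n)
  ≡⟨ ⊗-geomInv-0-⊗-suc [1+x]² (sq a) (suc n) ⟩
    [1+x]²/[1-x]·sq a (suc n) + ([1+x]² ⊗ sq a) (2 ℕ.+ n)
  ≡⟨ cong (_+ ([1+x]² ⊗ sq a) (2 ℕ.+ n)) (⊗-geomInv-0-⊗-suc [1+x]² (sq a) n) ⟩
    [1+x]²/[1-x]·sq a n + ([1+x]² ⊗ sq a) (suc n) + ([1+x]² ⊗ sq a) (2 ℕ.+ n)
  ≡⟨ +-assoc ([1+x]²/[1-x]·sq a n) _ _ ⟩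
    [1+x]²/[1-x]·sq a n + (([1+x]² ⊗ sq a) (suc n) + ([1+x]² ⊗ sq a) (2 ℕ.+ n)) ∎
  where open ≡-Reasoning

[1+x]²/[1-x]·sq-even : ∀ a m →
  [1+x]²/[1-x]·sq a (2 ℕ.+ (m ℕ.+ m)) ≡ [1+x]²/[1-x]·sq a (m ℕ.+ m) + (a (suc m) + + 3 * a m)
[1+x]²/[1-x]·sq-even a m =
  trans ([1+x]²/[1-x]·sq-suc-suc a (m ℕ.+ m))
        (cong (_+_ ([1+x]²/[1-x]·sq a (m ℕ.+ m)))
              (trans (cong₂ _+_ ([1+x]²-⊗-sq-odd a m) ([1+x]²-⊗-sq-even a m))
                     (collect (a (suc m)) (a m))))
  where
  collect : ∀ u v → + 2 * v + (u + v) ≡ u + + 3 * v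
  collect = solve-∀

[1+x]²/[1-x]·sq-odd : ∀ a m →
  [1+x]²/[1-x]·sq a (3 ℕ.+ (m ℕ.+ m))
    ≡ [1+x]²/[1-x]·sq a (suc (m ℕ.+ m)) + (+ 3 * a (suc m) + a m)
[1+x]²/[1-x]·sq-odd a m =
  trans ([1+x]²/[1-x]·sq-suc-suc a (suc (m ℕ.+ m)))
        (cong (_+_ ([1+x]²/[1-x]·sq a (suc (m ℕ.+ m))))
              (trans (cong₂ _+_ ([1+x]²-⊗-sq-even a m) ([1+x]²-⊗-sq-odd-suc a m))
                     (collect (a (suc m)) (a m))))
  where
  collect : ∀ u v → (u + v) + + 2 * u ≡ + 3 * u + v
  collect = solve-∀

x[1-2x²]/[1-x]²[2+n]≡2-n : ∀ n → (x[1-2x²] ⊗ geomInv 0 ⊗ geomInv 0) (2 ℕ.+ n) ≡ + 2 - + n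
x[1-2x²]/[1-x]²[2+n]≡2-n zero    = refl
x[1-2x²]/[1-x]²[2+n]≡2-n (suc n) = begin
    (x[1-2x²] ⊗ geomInv 0 ⊗ geomInv 0) (3 ℕ.+ n)
  ≡⟨ ⊗-geomInv-0-suc (x[1-2x²] ⊗ geomInv 0) (2 ℕ.+ n) ⟩
    (x[1-2x²] ⊗ geomInv 0 ⊗ geomInv 0) (2 ℕ.+ n) + (x[1-2x²] ⊗ geomInv 0) (3 ℕ.+ n)
  ≡⟨ cong₂ _+_ (x[1-2x²]/[1-x]²[2+n]≡2-n n) (x[1-2x²]/[1-x][3+n]≡-1 n) ⟩
    + 2 - + n - + 1
  ≡⟨ regroup (+ n) ⟩
    + 2 - + suc n ∎
  where
  open ≡-Reasoning
  x[1-2x²]/[1-x][3+n]≡-1 : ∀ n → (x[1-2x²] ⊗ geomInv 0) (3 ℕ.+ n) ≡ - + 1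
  x[1-2x²]/[1-x][3+n]≡-1 zero    = refl
  x[1-2x²]/[1-x][3+n]≡-1 (suc n) =
    trans (⊗-geomInv-0-suc x[1-2x²] (3 ℕ.+ n))
          (trans (+-identityʳ _) (x[1-2x²]/[1-x][3+n]≡-1 n))
  regroup : ∀ k → + 2 - k - + 1 ≡ + 2 - (+ 1 + k)
  regroup = solve-∀

x[1-2x²]/[1-x]²[1-x²]-suc-suc : ∀ n →
  x[1-2x²]/[1-x]²[1-x²] (2 ℕ.+ n) ≡ x[1-2x²]/[1-x]²[1-x²] n + (+ 2 - + n)
x[1-2x²]/[1-x]²[1-x²]-suc-suc n =
  trans (⊗-geomInv-1-suc-suc (x[1-2x²] ⊗ geomInv 0 ⊗ geomInv 0) n)
        (cong (_+_ (x[1-2x²]/[1-x]²[1-x²] n)) (x[1-2x²]/[1-x]²[2+n]≡2-n n))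

pos-sub-cancel : ∀ {s p q} → s ≡ p ℕ.+ q → + s - + q ≡ + p
pos-sub-cancel {p = p} {q} refl = cancel (+ p) (+ q)
  where
  cancel : ∀ x y → x + y - y ≡ x
  cancel = solve-∀

F-suc : ∀ n → F (suc n) ≡ F n + (+ Σb< (2 ℕ.+ n) - + 1)
F-suc n = begin
    F (suc n)
  ≡⟨ pos-sub-cancel (sym (f-suc n)) ⟨
    F n + + Σb< (2 ℕ.+ n) - + 1
  ≡⟨ +-assoc (F n) (+ Σb< (2 ℕ.+ n)) (- + 1) ⟩
    F n + (+ Σb< (2 ℕ.+ n) - + 1) ∎
  where open ≡-Reasoning

sumTo-B⊖X : ∀ n → sumTo (suc n) (B ⊖ X) ≡ + Σb< (2 ℕ.+ n) - + 1
sumTo-B⊖X zero    = refl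
sumTo-B⊖X (suc n) =
  trans (cong (_+ (B (2 ℕ.+ n) - + 0)) (sumTo-B⊖X n))
        (regroup (+ Σb< (2 ℕ.+ n)) (B (2 ℕ.+ n)))
  where
  regroup : ∀ s t → s - + 1 + (t - + 0) ≡ s + t - + 1
  regroup = solve-∀

F≡[B-x]/[1-x]² : ∀ n → F n ≡ ((B ⊖ X) ⊗ geomInv 0 ⊗ geomInv 0) n
F≡[B-x]/[1-x]² n = begin
    F n
  ≡⟨ sumTo-unique {F} refl (λ k → trans (F-suc k) (cong (_+_ (F k)) (sym (sumTo-B⊖X k)))) n ⟩
    sumTo n (λ k → sumTo k (B ⊖ X))
  ≡⟨ sumTo-cong n (λ k _ → ⊗-geomInv-0 (B ⊖ X) k) ⟨
    sumTo n ((B ⊖ X) ⊗ geomInv 0)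
  ≡⟨ ⊗-geomInv-0 ((B ⊖ X) ⊗ geomInv 0) n ⟨
    ((B ⊖ X) ⊗ geomInv 0 ⊗ geomInv 0) n ∎
  where open ≡-Reasoning

Δ₂F : ℕ → ℤ
Δ₂F n = + Σb< (2 ℕ.+ n) + + Σb< (3 ℕ.+ n) - + 2

F-suc-suc : ∀ n → F (2 ℕ.+ n) ≡ F n + Δ₂F n
F-suc-suc n = begin
    F (2 ℕ.+ n)
  ≡⟨ F-suc (suc n) ⟩
    F (suc n) + (+ Σb< (3 ℕ.+ n) - + 1)
  ≡⟨ cong (_+ (+ Σb< (3 ℕ.+ n) - + 1)) (F-suc n) ⟩
    F n + (+ Σb< (2 ℕ.+ n) - + 1) + (+ Σb< (3 ℕ.+ n) - + 1)
  ≡⟨ regroup (F n) (+ Σb< (2 ℕ.+ n)) (+ Σb< (3 ℕ.+ n)) ⟩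
    F n + Δ₂F n ∎
  where
  open ≡-Reasoning
  regroup : ∀ x s t → x + (s - + 1) + (t - + 1) ≡ x + (s + t - + 2)
  regroup = solve-∀

[1+x]²/[1-x]·sqF-suc-suc : ∀ n →
  [1+x]²/[1-x]·sq F (2 ℕ.+ n)
    ≡ [1+x]²/[1-x]·sq F n + (+ Σb< (2 ℕ.+ n) + + Σb< (3 ℕ.+ n) - + n)
[1+x]²/[1-x]·sqF-suc-suc n with evenOrOdd n
... | even m = begin
    [1+x]²/[1-x]·sq F (2 ℕ.+ M)
  ≡⟨ [1+x]²/[1-x]·sq-even F m ⟩
    [1+x]²/[1-x]·sq F M + (F (suc m) + + 3 * F m)
  ≡⟨ cong (λ t → [1+x]²/[1-x]·sq F M + (F (suc m) + t)) (pos-* 3 (f m)) ⟨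
    [1+x]²/[1-x]·sq F M + + (f (suc m) ℕ.+ 3 ℕ.* f m)
  ≡⟨ cong (_+_ ([1+x]²/[1-x]·sq F M)) (pos-sub-cancel (Σb<-pair-even m)) ⟨
    [1+x]²/[1-x]·sq F M + (+ Σb< (2 ℕ.+ M) + + Σb< (3 ℕ.+ M) - + M) ∎
  where
  open ≡-Reasoning
  M : ℕ
  M = m ℕ.+ m
... | odd m = begin
    [1+x]²/[1-x]·sq F (3 ℕ.+ M)
  ≡⟨ [1+x]²/[1-x]·sq-odd F m ⟩
    [1+x]²/[1-x]·sq F (suc M) + (+ 3 * F (suc m) + F m)
  ≡⟨ cong (λ t → [1+x]²/[1-x]·sq F (suc M) + (t + F m)) (pos-* 3 (f (suc m))) ⟨
    [1+x]²/[1-x]·sq F (suc M) + + (3 ℕ.* f (suc m) ℕ.+ f m)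
  ≡⟨ cong (_+_ ([1+x]²/[1-x]·sq F (suc M))) (pos-sub-cancel (Σb<-pair-odd m)) ⟨
    [1+x]²/[1-x]·sq F (suc M) + (+ Σb< (3 ℕ.+ M) + + Σb< (4 ℕ.+ M) - + suc M) ∎
  where
  open ≡-Reasoning
  M : ℕ
  M = m ℕ.+ m

rhs₂ : PS
rhs₂ = [1+x]²/[1-x]·sq F ⊖ x[1-2x²]/[1-x]²[1-x²]

rhs₂-suc-suc : ∀ n → rhs₂ (2 ℕ.+ n) ≡ rhs₂ n + Δ₂F n
rhs₂-suc-suc n =
  trans (cong₂ _-_ ([1+x]²/[1-x]·sqF-suc-suc n) (x[1-2x²]/[1-x]²[1-x²]-suc-suc n))
        (regroup ([1+x]²/[1-x]·sq F n) (x[1-2x²]/[1-x]²[1-x²] n)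
                 (+ Σb< (2 ℕ.+ n) + + Σb< (3 ℕ.+ n)) (+ n))
  where
  regroup : ∀ t r s k → t + (s - k) - (r + (+ 2 - k)) ≡ t - r + (s - + 2)
  regroup = solve-∀

corollary3 :
    ((n : ℕ) → F n ≡ ((B ⊖ X) ⊗ geomInv 0 ⊗ geomInv 0) n)
    × ((n : ℕ) → F n ≡ (poly (+ 1 ∷ + 2 ∷ + 1 ∷ []) ⊗ geomInv 0 ⊗ sq F
                         ⊖ poly (+ 0 ∷ + 1 ∷ + 0 ∷ -[1+ 1 ] ∷ [])
                             ⊗ geomInv 0 ⊗ geomInv 0 ⊗ geomInv 1) n)
corollary3 = F≡[B-x]/[1-x]² , agree-by-step2 Δ₂F refl refl F-suc-suc rhs₂-suc-suc
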